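{- Let $G$ be an HRLQ instance admitting a feasible envy-free matching, let $\ell_1$ be the maximum length of a resident's preference list and $\ell_2$ the maximum length of a hospital's preference list, and let $OPT$ be a maximum-size feasible envy-free matching of $G$. Let $M$ be any maximal envy-free matching of $G$. Then (I) if every hospital has quotas at most $1$, $|OPT|\le \ell_1\cdot|M|$ (i.e. $M$ is an $\ell_1$-approximation); (II) for arbitrary quotas, $|OPT|\le \ell_1\ell_2\cdot |M|$ (i.e. $M$ is an $(\ell_1\cdot\ell_2)$-approximation).
   Context: An HRLQ instance is a bipartite graph $G=(\mathcal{R}\cup\mathcal{H},E)$ with residents $\mathcal{R}$ and hospitals $\mathcal{H}$; $(r,h)\in E$ means mutual acceptability. Each hospital $h$ has an upper quota $q^+(h)$ and a lower quota $q^-(h)\le q^+(h)$. Every vertex ranks its neighbours strictly; $b_1>_a b_2$ means $a$ prefers $b_1$ to $b_2$; the preference list length of a vertex is its degree. A matching $M\subseteq E$ assigns each resident at most one hospital and each hospital $h$ at most $q^+(h)$ residents; $M(r)$ is $r$'s hospital ($\bot$ if unmatched, worst for $r$). $M$ is feasible if $|M(h)|\ge q^-(h)$ for all $h$. A resident $r$ envies a matched resident $r'$ with $M(r')=h$, $(r,h)\in E$, if $h>_r M(r)$ and $r>_h r'$; $M$ is envy-free if no such pair exists. An envy-free matching $M$ is a maximal envy-free matching if adding any edge of $E\setminus M$ to $M$ violates an upper quota or envy-freeness. -}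

module Defs where

open import Data.Nat using (ℕ; zero; suc; _+_; _*_; _≤_; _⊔_)
open import Data.Fin using (Fin; _≟_)
open import Data.List using (List; []; _∷_; _++_; length; map; foldr; allFin)
open import Data.Nat.ListAction using (sum)
open import Data.List.Membership.Propositional using (_∈_)
open import Data.List.Relation.Unary.Unique.Propositional using (Unique)
open import Data.Maybe using (Maybe; just; nothing)
open import Data.Product using (Σ; ∃; ∃-syntax; _×_; _,_)
open import Data.Unit using (⊤)
open import Data.Empty using (⊥)
open import Relation.Nullary using (¬_; yes; no)
open import Relation.Binary.PropositionalEquality using (_≡_)
open import Function.Bundles using (_⇔_)

-- ordering induced by a strict preference list (earlier = better):
-- x is ranked strictly above y in xs
Before : {A : Set} → List A → A → A → Set
Before {A} xs x y = Σ (List A) λ as → Σ (List A) λ bs → (xs ≡ as ++ (x ∷ bs)) × (y ∈ bs)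

count : (n : ℕ) → (Fin n → ℕ) → ℕ
count n f = sum (map f (allFin n))

maxOver : (n : ℕ) → (Fin n → ℕ) → ℕ
maxOver n f = foldr _⊔_ 0 (map f (allFin n))

-- Each vertex's preference list is the list of its neighbours, best first.
-- The edge set E is {(r,h) | h ∈ prefR r}, which must coincide with
-- {(r,h) | r ∈ prefH h} (mutual acceptability).
record HRLQ : Set where
  field
    nR nH   : ℕ
    prefR   : Fin nR → List (Fin nH)
    prefH   : Fin nH → List (Fin nR)
    uniqR   : ∀ r → Unique (prefR r)
    uniqH   : ∀ h → Unique (prefH h)
    mutualAcc : ∀ r h → (h ∈ prefR r) ⇔ (r ∈ prefH h)
    qlo qup : Fin nH → ℕ
    qlo≤qup : ∀ h → qlo h ≤ qup h

module _ (G : HRLQ) where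
  open HRLQ G

  Edge : Fin nR → Fin nH → Set
  Edge r h = h ∈ prefR r

  Assignment : Set
  Assignment = Fin nR → Maybe (Fin nH)

  isTo : Maybe (Fin nH) → Fin nH → ℕ
  isTo nothing  h = 0
  isTo (just h') h with h' ≟ h
  ... | yes _ = 1
  ... | no  _ = 0

  isMatched : Maybe (Fin nH) → ℕ
  isMatched nothing  = 0
  isMatched (just _) = 1

  load : Assignment → Fin nH → ℕ
  load m h = count nR (λ r → isTo (m r) h)

  size : Assignment → ℕ
  size m = count nR (λ r → isMatched (m r))

  IsMatching : Assignment → Set
  IsMatching m = (∀ r h → m r ≡ just h → Edge r h) × (∀ h → load m h ≤ qup h)

  Feasible : Assignment → Set
  Feasible m = ∀ h → qlo h ≤ load m h

  PrefersR : Fin nR → Fin nH → Maybe (Fin nH) → Set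
  PrefersR r h nothing   = ⊤
  PrefersR r h (just h') = Before (prefR r) h h'

  PrefersH : Fin nH → Fin nR → Fin nR → Set
  PrefersH h r r' = Before (prefH h) r r'

  Envies : Assignment → Fin nR → Fin nR → Set
  Envies m r r' = Σ (Fin nH) λ h → (m r' ≡ just h) × Edge r h × PrefersR r h (m r) × PrefersH h r r'

  EnvyFree : Assignment → Set
  EnvyFree m = ∀ r r' → ¬ Envies m r r'

  update : Assignment → Fin nR → Fin nH → Assignment
  update m r h r' with r ≟ r'
  ... | yes _ = just h
  ... | no  _ = m r'

  EnvyFreeMatching : Assignment → Set
  EnvyFreeMatching m = IsMatching m × EnvyFree m

  -- maximal: adding any edge (r,h) ∉ M yields no envy-free matching.
  -- Adding an edge at an already matched resident never gives a matching,
  -- so only unmatched residents need to be considered.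
  MaximalEnvyFree : Assignment → Set
  MaximalEnvyFree m = EnvyFreeMatching m ×
    (∀ r h → m r ≡ nothing → Edge r h → ¬ EnvyFreeMatching (update m r h))

  MaxFeasibleEnvyFree : Assignment → Set
  MaxFeasibleEnvyFree m = EnvyFreeMatching m × Feasible m ×
    (∀ n → EnvyFreeMatching n → Feasible n → size n ≤ size m)

  ℓ₁ : ℕ
  ℓ₁ = maxOver nR (λ r → length (prefR r))

  ℓ₂ : ℕ
  ℓ₂ = maxOver nH (λ h → length (prefH h))

-- If a hospital h with q⁺(h) ≥ 1 and a non-empty
-- list had no neighbour matched in M, nobody would be assigned to h and h's
-- favourite resident would be unmatched. Adding that pair to M creates no envy:
-- nobody outranks the favourite at h, and the favourite already envied nobody
-- while unmatched. This contradicts maximality, so every hospital that OPT fills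
-- is adjacent to an M-matched resident. Charging the at most q⁺(h) ≤ 1 (resp.
-- ℓ₂) residents that OPT sends to h to the M-matched neighbours of h, each
-- M-matched resident is charged by at most ℓ₁ hospitals.
module Submission where

open import Defs
open import Data.Nat using (ℕ; _≤_; _*_)
open import Data.Product using (_×_; ∃)
open import Data.Fin using (Fin)

open import Data.Nat using (zero; suc; _+_; _⊔_; z≤n)
open import Data.Nat.Properties hiding (_≟_)
open import Data.Nat.ListAction as ListAction using ()
open import Data.Fin using (zero; suc; _≟_; punchIn)
open import Data.Fin.Properties using (punchInᵢ≢i)
open import Data.List using (List; []; _∷_; length; map; tabulate; allFin)
open import Data.List.Properties using (map-tabulate; foldr-preservesᵒ)
open import Data.List.Membership.Propositional using (_∈_; lose; find)
open import Data.List.Membership.Propositional.Properties using (∈-map⁺; ∈-allFin; ∈-++⁺ʳ)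
open import Data.List.Relation.Unary.Any as Any using (Any; here; there; any?)
open import Data.List.Relation.Unary.All as All using ()
open import Data.List.Relation.Unary.AllPairs using (_∷_)
open import Data.List.Relation.Unary.Unique.Propositional using (Unique)
open import Data.Maybe using (Maybe; just; nothing; Is-just)
open import Data.Maybe.Properties using (≡-dec; just-injective)
open import Data.Maybe.Relation.Unary.Any as MaybeAny using ()
open import Data.Product using (_,_; proj₂)
open import Data.Sum using (_⊎_; inj₁; inj₂; [_,_])
open import Data.Unit using (tt)
open import Data.Empty using (⊥-elim)
open import Function using (_∘_; id)
open import Function.Bundles using (Equivalence)
open import Relation.Nullary using (¬_; Dec; yes; no; contradiction)
open import Relation.Binary.PropositionalEquality
  using (_≡_; _≢_; refl; sym; trans; cong; cong₂; subst; module ≡-Reasoning)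

open import Algebra.Properties.Semiring.Sum +-*-semiring
  using (sum; sum-syntax; sum-remove; sum-cong-≗; sum-replicate-zero;
         ∑-distrib-+; ∑-comm; *-distribˡ-sum; *-distribʳ-sum)

private variable
  P Q R : Set
  n : ℕ

indicator : Dec P → ℕ
indicator (yes _) = 1
indicator (no _)  = 0

indicator-yes : (P? : Dec P) → P → indicator P? ≡ 1
indicator-yes (yes _) _  = refl
indicator-yes (no ¬p) p = contradiction p ¬p

indicator-no : (P? : Dec P) → ¬ P → indicator P? ≡ 0
indicator-no (yes p) ¬p = contradiction p ¬p
indicator-no (no _)  _  = refl

indicator-mono : (P? : Dec P) (Q? : Dec Q) → (P → Q) → indicator P? ≤ indicator Q?
indicator-mono (yes p) Q? P⇒Q = ≤-reflexive (sym (indicator-yes Q? (P⇒Q p)))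
indicator-mono (no _)  Q? _   = z≤n

indicator-⊎ : (P? : Dec P) (Q? : Dec Q) (R? : Dec R) → (P → Q ⊎ R) →
              indicator P? ≤ indicator Q? + indicator R?
indicator-⊎ (no _)  Q? R? _ = z≤n
indicator-⊎ (yes p) Q? R? P⇒Q⊎R with P⇒Q⊎R p
... | inj₁ q = ≤-trans (indicator-mono (yes p) Q? (λ _ → q)) (m≤m+n _ _)
... | inj₂ r = ≤-trans (indicator-mono (yes p) R? (λ _ → r)) (m≤n+m _ _)

infix 4 _∈?_
_∈?_ : (i : Fin n) (xs : List (Fin n)) → Dec (i ∈ xs)
i ∈? xs = any? (i ≟_) xs

count≡∑ : (f : Fin n → ℕ) → count n f ≡ ∑[ i < n ] f i
count≡∑ {n} f = trans (cong ListAction.sum (map-tabulate id f)) (sum-tabulate n f)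
  where
  sum-tabulate : ∀ n (f : Fin n → ℕ) → ListAction.sum (tabulate f) ≡ sum f
  sum-tabulate zero    f = refl
  sum-tabulate (suc n) f = cong (f zero +_) (sum-tabulate n (f ∘ suc))

∑-mono-≤ : {f g : Fin n → ℕ} → (∀ i → f i ≤ g i) → sum f ≤ sum g
∑-mono-≤ {zero}  _   = z≤n
∑-mono-≤ {suc n} f≤g = +-mono-≤ (f≤g zero) (∑-mono-≤ (f≤g ∘ suc))

term≤∑ : (f : Fin n → ℕ) (i : Fin n) → f i ≤ sum f
term≤∑ {suc n} f i = ≤-trans (m≤m+n (f i) _) (≤-reflexive (sym (sum-remove {i = i} f)))

∑-≗-except : (f g : Fin n → ℕ) (i : Fin n) → (∀ j → j ≢ i → f j ≡ g j) →
             sum f + g i ≡ sum g + f i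
∑-≗-except {suc n} f g i f≗g = begin
  sum f + g i                          ≡⟨ cong (_+ g i) (sum-remove {i = i} f) ⟩
  f i + sum (f ∘ punchIn i) + g i      ≡⟨ cong (λ s → f i + s + g i) (sum-cong-≗ agree) ⟩
  f i + s + g i                        ≡⟨ +-assoc (f i) s (g i) ⟩
  f i + (s + g i)                      ≡⟨ +-comm (f i) (s + g i) ⟩
  s + g i + f i                        ≡⟨ cong (_+ f i) (+-comm s (g i)) ⟩
  g i + s + f i                        ≡⟨ cong (_+ f i) (sum-remove {i = i} g) ⟨
  sum g + f i                          ∎
  where
  open ≡-Reasoning
  s = sum (g ∘ punchIn i)
  agree : ∀ j → f (punchIn i j) ≡ g (punchIn i j)
  agree j = f≗g (punchIn i j) (punchInᵢ≢i i j)

∑-single : (f : Fin n → ℕ) (i : Fin n) → (∀ j → j ≢ i → f j ≡ 0) → sum f ≡ f i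
∑-single {n} f i f≡0 = begin
  sum f                 ≡⟨ +-identityʳ (sum f) ⟨
  sum f + 0             ≡⟨ ∑-≗-except f (λ _ → 0) i f≡0 ⟩
  ∑[ j < n ] 0 + f i    ≡⟨ cong (_+ f i) (sum-replicate-zero n) ⟩
  f i                   ∎
  where open ≡-Reasoning

∑-indicator-unique : {P : Fin n → Set} (P? : ∀ j → Dec (P j)) {i : Fin n} →
                     P i → (∀ j → P j → j ≡ i) → ∑[ j < n ] indicator (P? j) ≡ 1
∑-indicator-unique P? {i} Pi unique =
  trans (∑-single _ i (λ j j≢i → indicator-no (P? j) (j≢i ∘ unique j)))
        (indicator-yes (P? i) Pi)

∑-indicator-∈ : (xs : List (Fin n)) → ∑[ i < n ] indicator (i ∈? xs) ≤ length xs
∑-indicator-∈ {n} []       = ≤-reflexive (sum-replicate-zero n)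
∑-indicator-∈ {n} (x ∷ xs) = begin
  ∑[ i < n ] indicator (i ∈? x ∷ xs)
    ≤⟨ ∑-mono-≤ (λ i → indicator-⊎ (i ∈? x ∷ xs) (x ≟ i) (i ∈? xs) here-or-there) ⟩
  ∑[ i < n ] (indicator (x ≟ i) + indicator (i ∈? xs))
    ≡⟨ ∑-distrib-+ (λ i → indicator (x ≟ i)) (λ i → indicator (i ∈? xs)) ⟩
  ∑[ i < n ] indicator (x ≟ i) + ∑[ i < n ] indicator (i ∈? xs)
    ≤⟨ +-mono-≤ (≤-reflexive (∑-indicator-unique (x ≟_) refl (λ _ → sym)))
                (∑-indicator-∈ xs) ⟩
  1 + length xs
    ∎
  where
  open ≤-Reasoning
  here-or-there : ∀ {i} → i ∈ x ∷ xs → x ≡ i ⊎ i ∈ xs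
  here-or-there (here i≡x)   = inj₁ (sym i≡x)
  here-or-there (there i∈xs) = inj₂ i∈xs

≤-maxOver : (f : Fin n → ℕ) (i : Fin n) → f i ≤ maxOver n f
≤-maxOver {n} f i = foldr-preservesᵒ ⊔-preserves 0 (map f (allFin n))
  (inj₂ (Any.map ≤-reflexive (∈-map⁺ f (∈-allFin i))))
  where
  ⊔-preserves : ∀ x y → f i ≤ x ⊎ f i ≤ y → f i ≤ x ⊔ y
  ⊔-preserves x y = [ m≤n⇒m≤n⊔o y , m≤n⇒m≤o⊔n x ]

¬Before-head : {A : Set} {x a : A} {xs : List A} → Unique (x ∷ xs) → ¬ Before (x ∷ xs) a x
¬Before-head (x∉xs ∷ _) ([]     , bs , refl , x∈bs) = All.lookup x∉xs x∈bs refl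
¬Before-head (x∉xs ∷ _) (_ ∷ as , bs , refl , x∈bs) =
  All.lookup x∉xs (∈-++⁺ʳ as (there x∈bs)) refl

module _ (G : HRLQ) where
  open HRLQ G
  open Equivalence

  _≟ᴹ_ : (m m' : Maybe (Fin nH)) → Dec (m ≡ m')
  _≟ᴹ_ = ≡-dec _≟_

  isTo≡indicator : ∀ m h → isTo G m h ≡ indicator (m ≟ᴹ just h)
  isTo≡indicator nothing  h = refl
  isTo≡indicator (just x) h with x ≟ h
  ... | yes _ = refl
  ... | no  _ = refl

  isTo-self : ∀ h → isTo G (just h) h ≡ 1
  isTo-self h = trans (isTo≡indicator (just h) h) (indicator-yes (just h ≟ᴹ just h) refl)

  isTo-≢ : ∀ m h → m ≢ just h → isTo G m h ≡ 0
  isTo-≢ m h m≢h = trans (isTo≡indicator m h) (indicator-no (m ≟ᴹ just h) m≢h)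

  isMatched-just : ∀ m → Is-just m → isMatched G m ≡ 1
  isMatched-just (just _) _ = refl

  isMatched≡∑isTo : ∀ m → isMatched G m ≡ ∑[ h < nH ] isTo G m h
  isMatched≡∑isTo nothing  = sym (sum-replicate-zero nH)
  isMatched≡∑isTo (just x) = sym (trans
    (sum-cong-≗ (isTo≡indicator (just x)))
    (∑-indicator-unique (λ h → just x ≟ᴹ just h) refl (λ _ → sym ∘ just-injective)))

  size≡∑load : ∀ m → size G m ≡ ∑[ h < nH ] load G m h
  size≡∑load m = begin
    size G m                                 ≡⟨ count≡∑ (isMatched G ∘ m) ⟩
    ∑[ r < nR ] isMatched G (m r)            ≡⟨ sum-cong-≗ (isMatched≡∑isTo ∘ m) ⟩
    ∑[ r < nR ] ∑[ h < nH ] isTo G (m r) h   ≡⟨ ∑-comm (λ r h → isTo G (m r) h) ⟩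
    ∑[ h < nH ] ∑[ r < nR ] isTo G (m r) h   ≡⟨ sum-cong-≗ (λ h → count≡∑ (λ r → isTo G (m r) h)) ⟨
    ∑[ h < nH ] load G m h                   ∎
    where open ≡-Reasoning

  load-unassigned : ∀ m h → (∀ r → m r ≢ just h) → load G m h ≡ 0
  load-unassigned m h unassigned = begin
    load G m h                   ≡⟨ count≡∑ (λ r → isTo G (m r) h) ⟩
    ∑[ r < nR ] isTo G (m r) h   ≡⟨ sum-cong-≗ (λ r → isTo-≢ (m r) h (unassigned r)) ⟩
    ∑[ r < nR ] 0                ≡⟨ sum-replicate-zero nR ⟩
    0                            ∎
    where open ≡-Reasoning

  assigned⇒load-pos : ∀ m {r h} → m r ≡ just h → 1 ≤ load G m h
  assigned⇒load-pos m {r} {h} mr≡h = begin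
    1                            ≡⟨ isTo-self h ⟨
    isTo G (just h) h            ≡⟨ cong (λ m' → isTo G m' h) mr≡h ⟨
    isTo G (m r) h               ≤⟨ term≤∑ (λ r → isTo G (m r) h) r ⟩
    ∑[ r < nR ] isTo G (m r) h   ≡⟨ count≡∑ (λ r → isTo G (m r) h) ⟨
    load G m h                   ∎
    where open ≤-Reasoning

  load≤length : ∀ m → (∀ r h → m r ≡ just h → Edge G r h) → ∀ h → load G m h ≤ length (prefH h)
  load≤length m edges h = begin
    load G m h                             ≡⟨ count≡∑ (λ r → isTo G (m r) h) ⟩
    ∑[ r < nR ] isTo G (m r) h             ≤⟨ ∑-mono-≤ assigned⇒listed ⟩
    ∑[ r < nR ] indicator (r ∈? prefH h)   ≤⟨ ∑-indicator-∈ (prefH h) ⟩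
    length (prefH h)                       ∎
    where
    open ≤-Reasoning
    assigned⇒listed : ∀ r → isTo G (m r) h ≤ indicator (r ∈? prefH h)
    assigned⇒listed r = ≤-trans (≤-reflexive (isTo≡indicator (m r) h))
      (indicator-mono (m r ≟ᴹ just h) (r ∈? prefH h) (to (mutualAcc r h) ∘ edges r h))

  load≤ℓ₂ : ∀ m → IsMatching G m → ∀ h → load G m h ≤ ℓ₂ G
  load≤ℓ₂ m (edges , _) h =
    ≤-trans (load≤length m edges h) (≤-maxOver (λ h → length (prefH h)) h)

  update-self : ∀ m r h → update G m r h r ≡ just h
  update-self m r h with r ≟ r
  ... | yes _   = refl
  ... | no r≢r  = contradiction refl r≢r

  update-other : ∀ m {r r'} h → r ≢ r' → update G m r h r' ≡ m r'
  update-other m {r} {r'} h r≢r' with r ≟ r'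
  ... | yes r≡r' = contradiction r≡r' r≢r'
  ... | no _     = refl

  load-update : ∀ m {r} h h' → m r ≡ nothing →
                load G (update G m r h) h' ≡ load G m h' + isTo G (just h) h'
  load-update m {r} h h' mr≡nothing = begin
    load G u h'                      ≡⟨ count≡∑ (λ r' → isTo G (u r') h') ⟩
    ∑[ r' < nR ] isTo G (u r') h'    ≡⟨ +-identityʳ _ ⟨
    ∑[ r' < nR ] isTo G (u r') h' + isTo G nothing h'
      ≡⟨ cong (λ m' → ∑[ r' < nR ] isTo G (u r') h' + isTo G m' h') mr≡nothing ⟨
    ∑[ r' < nR ] isTo G (u r') h' + isTo G (m r) h'
      ≡⟨ ∑-≗-except (λ r' → isTo G (u r') h') (λ r' → isTo G (m r') h') r unchanged ⟩
    ∑[ r' < nR ] isTo G (m r') h' + isTo G (u r) h'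
      ≡⟨ cong₂ _+_ (count≡∑ (λ r' → isTo G (m r') h'))
                   (cong (λ m' → isTo G m' h') (sym (update-self m r h))) ⟨
    load G m h' + isTo G (just h) h' ∎
    where
    open ≡-Reasoning
    u = update G m r h
    unchanged : ∀ r' → r' ≢ r → isTo G (u r') h' ≡ isTo G (m r') h'
    unchanged r' r'≢r = cong (λ m' → isTo G m' h') (update-other m h (r'≢r ∘ sym))

  envies-update : ∀ m {r} h {a b} → m r ≡ nothing → b ≢ r →
                  Envies G (update G m r h) a b → Envies G m a b
  envies-update m {r} h {a} {b} mr≡nothing b≢r (h₁ , ub≡h₁ , a~h₁ , a-prefers , h₁-prefers) =
    h₁ , trans (sym (update-other m h (b≢r ∘ sym))) ub≡h₁ , a~h₁ , prefers-before (r ≟ a) , h₁-prefers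
    where
    prefers-before : Dec (r ≡ a) → PrefersR G a h₁ (m a)
    prefers-before (yes r≡a) =
      subst (λ a → PrefersR G a h₁ (m a)) r≡a (subst (PrefersR G r h₁) (sym mr≡nothing) tt)
    prefers-before (no r≢a) = subst (PrefersR G a h₁) (update-other m h r≢a) a-prefers

  update-envyFreeMatching : ∀ m {r h} → EnvyFreeMatching G m → m r ≡ nothing →
    (∀ r' → m r' ≢ just h) → Edge G r h → 1 ≤ qup h → (∀ a → ¬ PrefersH G h a r) →
    EnvyFreeMatching G (update G m r h)
  update-envyFreeMatching m {r} {h} ((edges , loads) , envyFree)
                          mr≡nothing unassigned r~h 1≤qup r-favourite =
    (edges′ , loads′) , envyFree′
    where
    u = update G m r h

    edges′ : ∀ r' h' → u r' ≡ just h' → Edge G r' h'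
    edges′ r' h' ur'≡h' with r ≟ r'
    ... | yes refl = subst (Edge G r) (just-injective ur'≡h') r~h
    ... | no _     = edges r' h' ur'≡h'

    loads′ : ∀ h' → load G u h' ≤ qup h'
    loads′ h' with h ≟ h'
    ... | yes refl = begin
      load G u h                       ≡⟨ load-update m h h mr≡nothing ⟩
      load G m h + isTo G (just h) h   ≡⟨ cong₂ _+_ (load-unassigned m h unassigned) (isTo-self h) ⟩
      1                                ≤⟨ 1≤qup ⟩
      qup h                            ∎
      where open ≤-Reasoning
    ... | no h≢h' = begin
      load G u h'                      ≡⟨ load-update m h h' mr≡nothing ⟩
      load G m h' + isTo G (just h) h' ≡⟨ cong (load G m h' +_) (isTo-≢ (just h) h' (h≢h' ∘ just-injective)) ⟩
      load G m h' + 0                  ≡⟨ +-identityʳ _ ⟩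
      load G m h'                      ≤⟨ loads h' ⟩
      qup h'                           ∎
      where open ≤-Reasoning

    envyFree′ : EnvyFree G u
    envyFree′ a b envy@(h₁ , ub≡h₁ , _ , _ , h₁-prefers) with b ≟ r
    ... | yes refl = r-favourite a
      (subst (λ h₁ → PrefersH G h₁ a r) (just-injective (trans (sym ub≡h₁) (update-self m r h))) h₁-prefers)
    ... | no b≢r = envyFree a b (envies-update m h mr≡nothing b≢r envy)

  Covered : Assignment G → Fin nH → Set
  Covered m h = Any (λ r → Is-just (m r)) (prefH h)

  covered? : ∀ m h → Dec (Covered m h)
  covered? m h = any? (λ r → MaybeAny.dec (λ _ → yes tt) (m r)) (prefH h)

  uncovered-unmatched : ∀ m {h r} → ¬ Covered m h → r ∈ prefH h → m r ≡ nothing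
  uncovered-unmatched m {r = r} ¬covered r∈ with m r in mr≡
  ... | nothing = refl
  ... | just _  = contradiction (lose r∈ (subst Is-just (sym mr≡) (MaybeAny.just tt))) ¬covered

  maximal⇒covered : ∀ {m h top rest} → MaximalEnvyFree G m → 1 ≤ qup h →
                    prefH h ≡ top ∷ rest → Covered m h
  maximal⇒covered {m} {h} {top} (efm@((edges , _) , _) , maximal) 1≤qup prefH≡
    with covered? m h
  ... | yes covered = covered
  ... | no ¬covered = ⊥-elim (maximal top h top-unmatched (from (mutualAcc top h) top∈)
          (update-envyFreeMatching m efm top-unmatched unassigned
             (from (mutualAcc top h) top∈) 1≤qup top-favourite))
    where
    top∈ : top ∈ prefH h
    top∈ = subst (top ∈_) (sym prefH≡) (here refl)

    top-unmatched : m top ≡ nothing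
    top-unmatched = uncovered-unmatched m ¬covered top∈

    unassigned : ∀ r → m r ≢ just h
    unassigned r mr≡h
      with () ← trans (sym (uncovered-unmatched m ¬covered (to (mutualAcc r h) (edges r h mr≡h)))) mr≡h

    top-favourite : ∀ a → ¬ PrefersH G h a top
    top-favourite a before =
      ¬Before-head (subst Unique prefH≡ (uniqH h)) (subst (λ xs → Before xs a top) prefH≡ before)

  filled⇒covered : ∀ {m m' r h} → MaximalEnvyFree G m → IsMatching G m' → m' r ≡ just h →
                   Covered m h
  filled⇒covered {m} {m'} {r} {h} maximal (edges , loads) m'r≡h =
    nonempty⇒covered (prefH h) refl (to (mutualAcc r h) (edges r h m'r≡h))
    where
    nonempty⇒covered : ∀ xs → prefH h ≡ xs → r ∈ xs → Covered m h
    nonempty⇒covered []      _      ()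
    nonempty⇒covered (_ ∷ _) prefH≡ _ =
      maximal⇒covered maximal (≤-trans (assigned⇒load-pos m' m'r≡h) (loads h)) prefH≡

  matchedNeighbours : Assignment G → Fin nH → ℕ
  matchedNeighbours m h = ∑[ r < nR ] (isMatched G (m r) * indicator (h ∈? prefR r))

  covered⇒matchedNeighbours-pos : ∀ m h → Covered m h → 1 ≤ matchedNeighbours m h
  covered⇒matchedNeighbours-pos m h covered with find covered
  ... | r , r∈ , matched = begin
    1
      ≡⟨ cong₂ _*_ (isMatched-just (m r) matched)
                   (indicator-yes (h ∈? prefR r) (from (mutualAcc r h) r∈)) ⟨
    isMatched G (m r) * indicator (h ∈? prefR r)
      ≤⟨ term≤∑ (λ r → isMatched G (m r) * indicator (h ∈? prefR r)) r ⟩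
    matchedNeighbours m h
      ∎
    where open ≤-Reasoning

  ∑matchedNeighbours≤ℓ₁*size : ∀ m → ∑[ h < nH ] matchedNeighbours m h ≤ ℓ₁ G * size G m
  ∑matchedNeighbours≤ℓ₁*size m = begin
    ∑[ h < nH ] ∑[ r < nR ] (μ r * a h r)   ≡⟨ ∑-comm (λ h r → μ r * a h r) ⟩
    ∑[ r < nR ] ∑[ h < nH ] (μ r * a h r)   ≡⟨ sum-cong-≗ (λ r → *-distribˡ-sum (μ r) (λ h → a h r)) ⟨
    ∑[ r < nR ] (μ r * ∑[ h < nH ] a h r)   ≤⟨ ∑-mono-≤ (λ r → *-monoʳ-≤ (μ r) (degree≤ℓ₁ r)) ⟩
    ∑[ r < nR ] (μ r * ℓ₁ G)                ≡⟨ *-distribʳ-sum (ℓ₁ G) μ ⟨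
    (∑[ r < nR ] μ r) * ℓ₁ G                ≡⟨ *-comm _ (ℓ₁ G) ⟩
    ℓ₁ G * ∑[ r < nR ] μ r                  ≡⟨ cong (ℓ₁ G *_) (count≡∑ μ) ⟨
    ℓ₁ G * size G m                         ∎
    where
    open ≤-Reasoning
    μ : Fin nR → ℕ
    μ r = isMatched G (m r)
    a : Fin nH → Fin nR → ℕ
    a h r = indicator (h ∈? prefR r)
    degree≤ℓ₁ : ∀ r → ∑[ h < nH ] a h r ≤ ℓ₁ G
    degree≤ℓ₁ r = ≤-trans (∑-indicator-∈ (prefR r)) (≤-maxOver (λ r → length (prefR r)) r)

  size≤ℓ₁*c*size : ∀ {m m'} c → MaximalEnvyFree G m → IsMatching G m' →
                   (∀ h → load G m' h ≤ c) → size G m' ≤ ℓ₁ G * c * size G m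
  size≤ℓ₁*c*size {m} {m'} c maximal matching load≤c = begin
    size G m'                               ≡⟨ size≡∑load m' ⟩
    ∑[ h < nH ] load G m' h                 ≤⟨ ∑-mono-≤ load≤c*matchedNeighbours ⟩
    ∑[ h < nH ] (c * matchedNeighbours m h) ≡⟨ *-distribˡ-sum c (matchedNeighbours m) ⟨
    c * ∑[ h < nH ] matchedNeighbours m h   ≤⟨ *-monoʳ-≤ c (∑matchedNeighbours≤ℓ₁*size m) ⟩
    c * (ℓ₁ G * size G m)                   ≡⟨ *-assoc c (ℓ₁ G) (size G m) ⟨
    c * ℓ₁ G * size G m                     ≡⟨ cong (_* size G m) (*-comm c (ℓ₁ G)) ⟩
    ℓ₁ G * c * size G m                     ∎
    where
    open ≤-Reasoning
    load≤c*matchedNeighbours : ∀ h → load G m' h ≤ c * matchedNeighbours m h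
    load≤c*matchedNeighbours h with covered? m h
    ... | yes covered = begin
      load G m' h                 ≤⟨ load≤c h ⟩
      c                           ≡⟨ *-identityʳ c ⟨
      c * 1                       ≤⟨ *-monoʳ-≤ c (covered⇒matchedNeighbours-pos m h covered) ⟩
      c * matchedNeighbours m h   ∎
    ... | no ¬covered = begin
      load G m' h                 ≡⟨ load-unassigned m' h (λ r → ¬covered ∘ filled⇒covered maximal matching) ⟩
      0                           ≤⟨ z≤n ⟩
      c * matchedNeighbours m h   ∎

theorem3 : (G : HRLQ) →
    ∃ (λ N → EnvyFreeMatching G N × Feasible G N) →
    (OPT : Assignment G) → MaxFeasibleEnvyFree G OPT →
    (M : Assignment G) → MaximalEnvyFree G M →
      ((∀ (h : Fin (HRLQ.nH G)) → HRLQ.qup G h ≤ 1) → size G OPT ≤ ℓ₁ G * size G M)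
      × (size G OPT ≤ (ℓ₁ G * ℓ₂ G) * size G M)
theorem3 G _ OPT ((matching , _) , _) M maximal = unit-quotas , general
  where
  unit-quotas : (∀ h → HRLQ.qup G h ≤ 1) → size G OPT ≤ ℓ₁ G * size G M
  unit-quotas qup≤1 =
    subst (size G OPT ≤_) (cong (_* size G M) (*-identityʳ (ℓ₁ G)))
      (size≤ℓ₁*c*size G 1 maximal matching (λ h → ≤-trans (proj₂ matching h) (qup≤1 h)))

  general : size G OPT ≤ (ℓ₁ G * ℓ₂ G) * size G M
  general = size≤ℓ₁*c*size G (ℓ₂ G) maximal matching (load≤ℓ₂ G OPT matching)
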